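{- For every formula $A$ there is a regular formula $M\Rightarrow Z$ such that $\mathbf{IPL}\vdash A$ if and only if $\mathbf{IPL}\vdash M\Rightarrow Z$, and such that for every Heyting algebra $\mathbf{H}$ and every interpretation $I$ in $\mathbf{H}$ with $V_I(M)=\mathsf{t}$ we have $V_I(A)\le V_I(Z)$.
   Context: Formulas are built from propositional variables, constants $\bot,\top$ and connectives $\land,\lor,\Rightarrow$; $\lnot A$ abbreviates $A\Rightarrow\bot$. $\mathbf{IPL}\vdash A$ means $A$ is provable in intuitionistic propositional logic. For a Heyting algebra $\mathbf{H}$ and a map $I$ from variables to $H$, $V_I$ extends $I$ to all formulas by interpreting $\bot,\top,\land,\lor,\Rightarrow$ as $\mathsf{f},\mathsf{t},\sqcap,\sqcup,\rightarrow$. A formula is reduced if $\top$ does not occur as an operand of any connective and $\bot$ occurs as an operand only as the right-hand operand of $\Rightarrow$. A formula is basic if it is reduced and is either a variable or has the form $P \Rightarrow B$ or $B \Rightarrow P$ with $P$ a variable and $B$ a formula containing at most one connective. A basic context is a reduced formula that is a conjunction of one or more pairwise distinct basic formulas. A regular formula is an implication $K\Rightarrow F$ with $K$ a basic context and $F$ a variable or $\bot$. -}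

module Defs where

open import Level using (Level)
open import Data.Nat using (ℕ; zero; suc; _+_; _≤_)
open import Data.List using (List; []; _∷_; _++_)
open import Data.List.Membership.Propositional using (_∈_)
open import Data.List.Relation.Unary.All using (All)
open import Data.List.Relation.Unary.Unique.Propositional using (Unique)
open import Data.Product using (Σ; _×_; _,_)
open import Data.Sum using (_⊎_)
open import Relation.Binary.PropositionalEquality using (_≡_; _≢_)
open import Relation.Binary.Lattice using (HeytingAlgebra)

infixr 6 _∧'_
infixr 5 _∨'_
infixr 4 _⇒_
data Fm : Set where
  var  : ℕ → Fm
  ⊥'   : Fm
  ⊤'   : Fm
  _∧'_ : Fm → Fm → Fm
  _∨'_ : Fm → Fm → Fm
  _⇒_  : Fm → Fm → Fm

¬' : Fm → Fm
¬' A = A ⇒ ⊥'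

infix 2 _⊢_
data _⊢_ (Γ : List Fm) : Fm → Set where
  ax   : ∀ {A} → A ∈ Γ → Γ ⊢ A
  ⊤I   : Γ ⊢ ⊤'
  ⊥E   : ∀ {A} → Γ ⊢ ⊥' → Γ ⊢ A
  ∧I   : ∀ {A B} → Γ ⊢ A → Γ ⊢ B → Γ ⊢ A ∧' B
  ∧E₁  : ∀ {A B} → Γ ⊢ A ∧' B → Γ ⊢ A
  ∧E₂  : ∀ {A B} → Γ ⊢ A ∧' B → Γ ⊢ B
  ∨I₁  : ∀ {A B} → Γ ⊢ A → Γ ⊢ A ∨' B
  ∨I₂  : ∀ {A B} → Γ ⊢ B → Γ ⊢ A ∨' B
  ∨E   : ∀ {A B C} → Γ ⊢ A ∨' B → (A ∷ Γ) ⊢ C → (B ∷ Γ) ⊢ C → Γ ⊢ C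
  ⇒I   : ∀ {A B} → (A ∷ Γ) ⊢ B → Γ ⊢ A ⇒ B
  ⇒E   : ∀ {A B} → Γ ⊢ A ⇒ B → Γ ⊢ A → Γ ⊢ B

IPL⊢ : Fm → Set
IPL⊢ A = [] ⊢ A

module _ {c ℓ₁ ℓ₂ : Level} (H : HeytingAlgebra c ℓ₁ ℓ₂) where
  open HeytingAlgebra H
  V : (ℕ → Carrier) → Fm → Carrier
  V I (var p)   = I p
  V I ⊥'        = ⊥
  V I ⊤'        = ⊤
  V I (A ∧' B)  = V I A ∧ V I B
  V I (A ∨' B)  = V I A ∨ V I B
  V I (A ⇒ B)   = V I A ⇨ V I B

Reduced : Fm → Set
Reduced (var _)  = Data.Unit.⊤ where import Data.Unit
Reduced ⊥'       = Data.Unit.⊤ where import Data.Unit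
Reduced ⊤'       = Data.Unit.⊤ where import Data.Unit
Reduced (A ∧' B) = A ≢ ⊤' × B ≢ ⊤' × A ≢ ⊥' × B ≢ ⊥' × Reduced A × Reduced B
Reduced (A ∨' B) = A ≢ ⊤' × B ≢ ⊤' × A ≢ ⊥' × B ≢ ⊥' × Reduced A × Reduced B
Reduced (A ⇒ B)  = A ≢ ⊤' × B ≢ ⊤' × A ≢ ⊥' × Reduced A × Reduced B

conn : Fm → ℕ
conn (var _)  = 0
conn ⊥'       = 0
conn ⊤'       = 0
conn (A ∧' B) = suc (conn A + conn B)
conn (A ∨' B) = suc (conn A + conn B)
conn (A ⇒ B)  = suc (conn A + conn B)

Basic : Fm → Set
Basic F = Reduced F ×
  ( (Σ ℕ λ P → F ≡ var P)
  ⊎ (Σ ℕ λ P → Σ Fm λ B → F ≡ (var P ⇒ B) × conn B ≤ 1)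
  ⊎ (Σ ℕ λ P → Σ Fm λ B → F ≡ (B ⇒ var P) × conn B ≤ 1) )

conjuncts : Fm → List Fm
conjuncts (A ∧' B) = conjuncts A ++ conjuncts B
conjuncts F        = F ∷ []

BasicContext : Fm → Set
BasicContext K = Reduced K × All Basic (conjuncts K) × Unique (conjuncts K)

Regular : Fm → Set
Regular (K ⇒ F) = BasicContext K × ((Σ ℕ λ P → F ≡ var P) ⊎ F ≡ ⊥')
Regular _       = Data.Empty.⊥ where import Data.Empty

module Submission where

-- Proof idea: name every subformula by a fresh variable (Tseitin-style).
-- Starting from a variable k above all variables of A, the non-variable
-- subformulas of A receive fresh names in post-order: ⊥ and ⊤ named x are
-- described by the conjuncts x ⇒ ⊥ and (x ⇒ x) ⇒ x, and a compound C ∘ D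
-- named r by r ⇒ (a ∘ b) and (a ∘ b) ⇒ r, where a, b name C, D.  M is the
-- conjunction of these naming conjuncts, prefixed by the trivial 0 ⇒ 0 so
-- that it is never empty, and Z is the name of A.
--   * Shape: naming conjuncts are basic; they are pairwise distinct because
--     each displays the variable it defines, and distinct subformulas define
--     variables in disjoint ranges.
--   * Naming lemma: in any congruent preorder on formulas (an "entailment")
--     validating the naming conjuncts, every subformula is equivalent to its
--     name.  For derivability from M this yields IPL ⊢ A ⇒ IPL ⊢ M ⇒ Z; for a
--     Heyting valuation making M true it yields V(A) ≤ V(Z).
--   * Conversely, substituting each name by the subformula it names turns
--     every naming conjunct into an identity X ⇒ X and Z into A, so a
--     derivation of M ⇒ Z becomes one of A.

open import Defs
open import Level using (Level; 0ℓ) renaming (suc to lsuc)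
open import Data.Nat using (ℕ; suc; _≤_; _<_; _⊔_; z≤n; s≤s)
open import Data.Nat.Properties using (_≟_; ≤-refl; ≤-trans; <⇒≢; <⇒≱; <-≤-trans; n≤1+n; m≤n⇒m≤1+n; m⊔n≤o⇒m≤o; m⊔n≤o⇒n≤o)
open import Data.Product using (Σ; _×_; _,_; proj₁; proj₂)
open import Data.Sum using (inj₁; inj₂)
open import Data.List using (List; []; _∷_; _++_; map)
open import Data.List.Membership.Propositional using (_∈_)
open import Data.List.Membership.Propositional.Properties using (∈-map⁺)
open import Data.List.Relation.Unary.Any using (here; there)
open import Data.List.Relation.Unary.All as All using (All; []; _∷_)
import Data.List.Relation.Unary.All.Properties as AllP
open import Data.List.Relation.Unary.AllPairs using ([]; _∷_)
open import Data.List.Relation.Unary.Unique.Propositional using (Unique)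
import Data.List.Relation.Unary.Unique.Propositional.Properties as UniqueP
open import Data.List.Relation.Binary.Disjoint.Propositional using (Disjoint)
open import Data.Unit using (⊤; tt)
open import Data.Empty using (⊥-elim)
open import Relation.Nullary using (yes; no)
open import Relation.Binary.PropositionalEquality using (_≡_; _≢_; refl; sym; trans; cong₂; subst; module ≡-Reasoning)
open import Function.Bundles using (_⇔_; mk⇔)
open import Relation.Binary.Lattice using (HeytingAlgebra)

data Op : Set where
  ∧o ∨o ⇒o : Op

binop : Op → Fm → Fm → Fm
binop ∧o = _∧'_
binop ∨o = _∨'_
binop ⇒o = _⇒_

conj : Fm → List Fm → Fm
conj F []       = F
conj F (G ∷ Gs) = F ∧' conj G Gs

-- next B k: the first variable still unused after naming B from k on.
next : Fm → ℕ → ℕ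
next (var _)  k = k
next ⊥'       k = suc k
next ⊤'       k = suc k
next (C ∧' D) k = suc (next D (next C k))
next (C ∨' D) k = suc (next D (next C k))
next (C ⇒ D)  k = suc (next D (next C k))

name : Fm → ℕ → ℕ
name (var y)  k = y
name ⊥'       k = k
name ⊤'       k = k
name (C ∧' D) k = next D (next C k)
name (C ∨' D) k = next D (next C k)
name (C ⇒ D)  k = next D (next C k)

link : Op → ℕ → ℕ → ℕ → List Fm
link o a b r = (var r ⇒ binop o (var a) (var b)) ∷ (binop o (var a) (var b) ⇒ var r) ∷ []

mutual
  defs : Fm → ℕ → List Fm
  defs (var _)  k = []
  defs ⊥'       k = (var k ⇒ ⊥') ∷ []
  defs ⊤'       k = ((var k ⇒ var k) ⇒ var k) ∷ []
  defs (C ∧' D) k = defsNode ∧o C D k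
  defs (C ∨' D) k = defsNode ∨o C D k
  defs (C ⇒ D)  k = defsNode ⇒o C D k

  defsNode : Op → Fm → Fm → ℕ → List Fm
  defsNode o C D k =
    defs C k ++ defs D (next C k) ++ link o (name C k) (name D (next C k)) (next D (next C k))

next-≥ : ∀ B k → k ≤ next B k
next-≥ (var _)  k = ≤-refl
next-≥ ⊥'       k = n≤1+n k
next-≥ ⊤'       k = n≤1+n k
next-≥ (C ∧' D) k = m≤n⇒m≤1+n (≤-trans (next-≥ C k) (next-≥ D (next C k)))
next-≥ (C ∨' D) k = m≤n⇒m≤1+n (≤-trans (next-≥ C k) (next-≥ D (next C k)))
next-≥ (C ⇒ D)  k = m≤n⇒m≤1+n (≤-trans (next-≥ C k) (next-≥ D (next C k)))

-- All variables of a formula lie below n; fresh names must start above them.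
VarsBelow : ℕ → Fm → Set
VarsBelow n (var y)  = y < n
VarsBelow n ⊥'       = ⊤
VarsBelow n ⊤'       = ⊤
VarsBelow n (C ∧' D) = VarsBelow n C × VarsBelow n D
VarsBelow n (C ∨' D) = VarsBelow n C × VarsBelow n D
VarsBelow n (C ⇒ D)  = VarsBelow n C × VarsBelow n D

bound : Fm → ℕ
bound (var y)  = suc y
bound ⊥'       = 0
bound ⊤'       = 0
bound (C ∧' D) = bound C ⊔ bound D
bound (C ∨' D) = bound C ⊔ bound D
bound (C ⇒ D)  = bound C ⊔ bound D

varsBelow : ∀ B {n} → bound B ≤ n → VarsBelow n B
varsBelow (var y)  b = b
varsBelow ⊥'       b = tt
varsBelow ⊤'       b = tt
varsBelow (C ∧' D) b = varsBelow C (m⊔n≤o⇒m≤o _ _ b) , varsBelow D (m⊔n≤o⇒n≤o _ _ b)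
varsBelow (C ∨' D) b = varsBelow C (m⊔n≤o⇒m≤o _ _ b) , varsBelow D (m⊔n≤o⇒n≤o _ _ b)
varsBelow (C ⇒ D)  b = varsBelow C (m⊔n≤o⇒m≤o _ _ b) , varsBelow D (m⊔n≤o⇒n≤o _ _ b)

-- The variable a naming conjunct defines: the variable alone on one side of ⇒.
head : Fm → ℕ
head (var p ⇒ _) = p
head (_ ⇒ var p) = p
head _           = 0

link-head : ∀ o a b r → All (λ F → head F ≡ r) (link o a b r)
link-head ∧o a b r = refl ∷ refl ∷ []
link-head ∨o a b r = refl ∷ refl ∷ []
link-head ⇒o a b r = refl ∷ refl ∷ []

record InRange (lo hi : ℕ) (F : Fm) : Set where
  constructor within
  field
    lower : lo ≤ head F
    upper : head F < hi

mutual
  defs-range : ∀ B k → All (InRange k (next B k)) (defs B k)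
  defs-range (var _)  k = []
  defs-range ⊥'       k = within ≤-refl ≤-refl ∷ []
  defs-range ⊤'       k = within ≤-refl ≤-refl ∷ []
  defs-range (C ∧' D) k = defsNode-range ∧o C D k
  defs-range (C ∨' D) k = defsNode-range ∨o C D k
  defs-range (C ⇒ D)  k = defsNode-range ⇒o C D k

  defsNode-range : ∀ o C D k → All (InRange k (suc (next D (next C k)))) (defsNode o C D k)
  defsNode-range o C D k =
    AllP.++⁺ (All.map widenC (defs-range C k))
      (AllP.++⁺ (All.map widenD (defs-range D e₁)) (All.map atTop (link-head o _ _ e₂)))
    where
    e₁ e₂ : ℕ
    e₁ = next C k
    e₂ = next D e₁
    widenC : ∀ {F} → InRange k e₁ F → InRange k (suc e₂) F
    widenC (within k≤h h<e₁) = within k≤h (<-≤-trans h<e₁ (m≤n⇒m≤1+n (next-≥ D e₁)))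
    widenD : ∀ {F} → InRange e₁ e₂ F → InRange k (suc e₂) F
    widenD (within e₁≤h h<e₂) = within (≤-trans (next-≥ C k) e₁≤h) (m≤n⇒m≤1+n h<e₂)
    atTop : ∀ {F} → head F ≡ e₂ → InRange k (suc e₂) F
    atTop h≡e₂ = within (subst (k ≤_) (sym h≡e₂) (≤-trans (next-≥ C k) (next-≥ D e₁))) (subst (_< suc e₂) (sym h≡e₂) ≤-refl)

disjoint-by-head : ∀ {xs ys} b → All (λ F → head F < b) xs → All (λ F → b ≤ head F) ys → Disjoint xs ys
disjoint-by-head b below above (v∈xs , v∈ys) = <⇒≱ (All.lookup below v∈xs) (All.lookup above v∈ys)

defs-avoid : ∀ {G} B k → head G < k → All (G ≢_) (defs B k)
defs-avoid B k h<k = All.map (λ (within k≤h _) G≡F → <⇒≱ h<k (subst (λ F → k ≤ head F) (sym G≡F) k≤h)) (defs-range B k)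

link-unique : ∀ o a b r → Unique (link o a b r)
link-unique ∧o a b r = ((λ ()) ∷ []) ∷ [] ∷ []
link-unique ∨o a b r = ((λ ()) ∷ []) ∷ [] ∷ []
link-unique ⇒o a b r = ((λ ()) ∷ []) ∷ [] ∷ []

mutual
  defs-unique : ∀ B k → Unique (defs B k)
  defs-unique (var _)  k = []
  defs-unique ⊥'       k = [] ∷ []
  defs-unique ⊤'       k = [] ∷ []
  defs-unique (C ∧' D) k = defsNode-unique ∧o C D k
  defs-unique (C ∨' D) k = defsNode-unique ∨o C D k
  defs-unique (C ⇒ D)  k = defsNode-unique ⇒o C D k

  -- The parts for C, for D and the link occupy [k,e₁), [e₁,e₂) and {e₂}.
  defsNode-unique : ∀ o C D k → Unique (defsNode o C D k)
  defsNode-unique o C D k =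
    UniqueP.++⁺ (defs-unique C k)
      (UniqueP.++⁺ (defs-unique D e₁) (link-unique o _ _ e₂)
        (disjoint-by-head e₂ (All.map InRange.upper (defs-range D e₁)) (linkAbove ≤-refl)))
      (disjoint-by-head e₁ (All.map InRange.upper (defs-range C k))
        (AllP.++⁺ (All.map InRange.lower (defs-range D e₁)) (linkAbove (next-≥ D e₁))))
    where
    e₁ e₂ : ℕ
    e₁ = next C k
    e₂ = next D e₁
    linkAbove : ∀ {b} → b ≤ e₂ → All (λ F → b ≤ head F) (link o (name C k) (name D e₁) e₂)
    linkAbove b≤e₂ = All.map (λ h≡e₂ → subst (_ ≤_) (sym h≡e₂) b≤e₂) (link-head o _ _ e₂)

basic-var⇒ : ∀ {r X} → Reduced X → X ≢ ⊤' → conn X ≤ 1 → Basic (var r ⇒ X)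
basic-var⇒ {r} {X} red X≢⊤ c = ((λ ()) , X≢⊤ , (λ ()) , tt , red) , inj₂ (inj₁ (r , X , refl , c))

basic-⇒var : ∀ {r X} → Reduced X → X ≢ ⊤' → X ≢ ⊥' → conn X ≤ 1 → Basic (X ⇒ var r)
basic-⇒var {r} {X} red X≢⊤ X≢⊥ c = (X≢⊤ , (λ ()) , X≢⊥ , red , tt) , inj₂ (inj₂ (r , X , refl , c))

node-shape : ∀ o a b → Reduced (binop o (var a) (var b)) × binop o (var a) (var b) ≢ ⊤' ×
                         binop o (var a) (var b) ≢ ⊥' × conn (binop o (var a) (var b)) ≤ 1
node-shape ∧o a b = ((λ ()) , (λ ()) , (λ ()) , (λ ()) , tt , tt) , (λ ()) , (λ ()) , s≤s z≤n
node-shape ∨o a b = ((λ ()) , (λ ()) , (λ ()) , (λ ()) , tt , tt) , (λ ()) , (λ ()) , s≤s z≤n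
node-shape ⇒o a b = ((λ ()) , (λ ()) , (λ ()) , tt , tt) , (λ ()) , (λ ()) , s≤s z≤n

link-basic : ∀ o a b r → All Basic (link o a b r)
link-basic o a b r =
  let (red , ≢⊤ , ≢⊥ , c) = node-shape o a b
  in basic-var⇒ red ≢⊤ c ∷ basic-⇒var red ≢⊤ ≢⊥ c ∷ []

mutual
  defs-basic : ∀ B k → All Basic (defs B k)
  defs-basic (var _)  k = []
  defs-basic ⊥'       k = basic-var⇒ tt (λ ()) z≤n ∷ []
  defs-basic ⊤'       k = basic-⇒var ((λ ()) , (λ ()) , (λ ()) , tt , tt) (λ ()) (λ ()) (s≤s z≤n) ∷ []
  defs-basic (C ∧' D) k = defsNode-basic ∧o C D k
  defs-basic (C ∨' D) k = defsNode-basic ∨o C D k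
  defs-basic (C ⇒ D)  k = defsNode-basic ⇒o C D k

  defsNode-basic : ∀ o C D k → All Basic (defsNode o C D k)
  defsNode-basic o C D k =
    AllP.++⁺ (defs-basic C k) (AllP.++⁺ (defs-basic D (next C k)) (link-basic o _ _ _))

-- The always-true conjunct 0 ⇒ 0 keeps the context a non-empty conjunction.
trivial : Fm
trivial = var 0 ⇒ var 0

trivial-basic : Basic trivial
trivial-basic = basic-var⇒ tt (λ ()) z≤n

basic-conjuncts : ∀ {F} → Basic F → conjuncts F ≡ F ∷ []
basic-conjuncts (_ , inj₁ (_ , refl))                = refl
basic-conjuncts (_ , inj₂ (inj₁ (_ , _ , refl , _))) = refl
basic-conjuncts (_ , inj₂ (inj₂ (_ , _ , refl , _))) = refl

basic≢⊤ : ∀ {F} → Basic F → F ≢ ⊤'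
basic≢⊤ (_ , inj₁ (_ , refl))                ()
basic≢⊤ (_ , inj₂ (inj₁ (_ , _ , refl , _))) ()
basic≢⊤ (_ , inj₂ (inj₂ (_ , _ , refl , _))) ()

basic≢⊥ : ∀ {F} → Basic F → F ≢ ⊥'
basic≢⊥ (_ , inj₁ (_ , refl))                ()
basic≢⊥ (_ , inj₂ (inj₁ (_ , _ , refl , _))) ()
basic≢⊥ (_ , inj₂ (inj₂ (_ , _ , refl , _))) ()

conj-conjuncts : ∀ {F} Gs → Basic F → All Basic Gs → conjuncts (conj F Gs) ≡ F ∷ Gs
conj-conjuncts []       bF []           = basic-conjuncts bF
conj-conjuncts (G ∷ Gs) bF (bG ∷ bGs) = cong₂ _++_ (basic-conjuncts bF) (conj-conjuncts Gs bG bGs)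

conj-reduced : ∀ {F} Gs → Basic F → All Basic Gs → Reduced (conj F Gs) × conj F Gs ≢ ⊤' × conj F Gs ≢ ⊥'
conj-reduced []       bF []           = proj₁ bF , basic≢⊤ bF , basic≢⊥ bF
conj-reduced (G ∷ Gs) bF (bG ∷ bGs) =
  let (red , ≢⊤ , ≢⊥) = conj-reduced Gs bG bGs
  in (basic≢⊤ bF , ≢⊤ , basic≢⊥ bF , ≢⊥ , proj₁ bF , red) , (λ ()) , (λ ())

conj-basicContext : ∀ {F} Gs → Basic F → All Basic Gs → Unique (F ∷ Gs) → BasicContext (conj F Gs)
conj-basicContext {F} Gs bF bGs u =
  proj₁ (conj-reduced Gs bF bGs) , subst (All Basic) (sym cs) (bF ∷ bGs) , subst Unique (sym cs) u
  where
  cs : conjuncts (conj F Gs) ≡ F ∷ Gs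
  cs = conj-conjuncts Gs bF bGs

record Entailment ℓ : Set (lsuc ℓ) where
  infix 4 _≼_
  field
    Valid      : Fm → Set ℓ
    _≼_        : Fm → Fm → Set ℓ
    ≼-refl     : ∀ {X} → X ≼ X
    ≼-trans    : ∀ {X Y Z} → X ≼ Y → Y ≼ Z → X ≼ Z
    binop-cong : ∀ o {C c D d} → C ≼ c → c ≼ C → D ≼ d → d ≼ D → binop o C D ≼ binop o c d
    ⊥-least    : ∀ {X} → ⊥' ≼ X
    ⊤-greatest : ∀ {X} → X ≼ ⊤'
    ⊤≼X⇒X      : ∀ {X} → ⊤' ≼ (X ⇒ X)
    valid-⇒    : ∀ {X Y} → Valid (X ⇒ Y) → X ≼ Y
    valid-∧    : ∀ {X Y} → Valid (X ∧' Y) → Valid X × Valid Y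

module Naming {ℓ} (E : Entailment ℓ) where
  open Entailment E

  _≃_ : Fm → Fm → Set ℓ
  X ≃ Y = X ≼ Y × Y ≼ X

  conj-valid : ∀ F Gs → Valid (conj F Gs) → All Valid (F ∷ Gs)
  conj-valid F []       v = v ∷ []
  conj-valid F (G ∷ Gs) v = let (vF , vGs) = valid-∧ v in vF ∷ conj-valid G Gs vGs

  linked : ∀ o {a b r C D} → All Valid (link o a b r) → C ≃ var a → D ≃ var b → binop o C D ≃ var r
  linked o (r⇒N ∷ N⇒r ∷ []) (C≼a , a≼C) (D≼b , b≼D) =
    ≼-trans (binop-cong o C≼a a≼C D≼b b≼D) (valid-⇒ N⇒r) ,
    ≼-trans (valid-⇒ r⇒N) (binop-cong o a≼C C≼a b≼D D≼b)

  mutual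
    named : ∀ B k → All Valid (defs B k) → B ≃ var (name B k)
    named (var _)  k _        = ≼-refl , ≼-refl
    named ⊥'       k (v ∷ []) = ⊥-least , valid-⇒ v
    named ⊤'       k (v ∷ []) = ≼-trans ⊤≼X⇒X (valid-⇒ v) , ⊤-greatest
    named (C ∧' D) k          = namedNode ∧o C D k
    named (C ∨' D) k          = namedNode ∨o C D k
    named (C ⇒ D)  k          = namedNode ⇒o C D k

    namedNode : ∀ o C D k → All Valid (defsNode o C D k) → binop o C D ≃ var (next D (next C k))
    namedNode o C D k vs =
      let (vC , vDL) = AllP.++⁻ (defs C k) vs
          (vD , vL)  = AllP.++⁻ (defs D (next C k)) vDL
      in linked o vL (named C k vC) (named D (next C k) vD)

  context-named : ∀ F B k → Valid (conj F (defs B k)) → B ≃ var (name B k)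
  context-named F B k v = named B k (All.tail (conj-valid F (defs B k) v))

extend-⊆ : ∀ {Γ Δ : List Fm} {B} → (∀ {x} → x ∈ Γ → x ∈ Δ) → ∀ {x} → x ∈ B ∷ Γ → x ∈ B ∷ Δ
extend-⊆ f (here p)  = here p
extend-⊆ f (there p) = there (f p)

wk : ∀ {Γ Δ A} → (∀ {x} → x ∈ Γ → x ∈ Δ) → Γ ⊢ A → Δ ⊢ A
wk f (ax x)     = ax (f x)
wk f ⊤I         = ⊤I
wk f (⊥E d)     = ⊥E (wk f d)
wk f (∧I d e)   = ∧I (wk f d) (wk f e)
wk f (∧E₁ d)    = ∧E₁ (wk f d)
wk f (∧E₂ d)    = ∧E₂ (wk f d)
wk f (∨I₁ d)    = ∨I₁ (wk f d)
wk f (∨I₂ d)    = ∨I₂ (wk f d)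
wk f (∨E d e g) = ∨E (wk f d) (wk (extend-⊆ f) e) (wk (extend-⊆ f) g)
wk f (⇒I d)     = ⇒I (wk (extend-⊆ f) d)
wk f (⇒E d e)   = ⇒E (wk f d) (wk f e)

wk1 : ∀ {Γ A B} → Γ ⊢ A → B ∷ Γ ⊢ A
wk1 = wk there

⇒-refl : ∀ {Γ X} → Γ ⊢ X ⇒ X
⇒-refl = ⇒I (ax (here refl))

⇒-trans : ∀ {Γ X Y Z} → Γ ⊢ X ⇒ Y → Γ ⊢ Y ⇒ Z → Γ ⊢ X ⇒ Z
⇒-trans f g = ⇒I (⇒E (wk1 g) (⇒E (wk1 f) (ax (here refl))))

-- Derivable equivalence is a congruence for the connectives; ⇒ uses the
-- converse direction for its contravariant antecedent.
⊢-binop-cong : ∀ {Γ} o {C c D d} → Γ ⊢ C ⇒ c → Γ ⊢ c ⇒ C → Γ ⊢ D ⇒ d → Γ ⊢ d ⇒ D →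
  Γ ⊢ binop o C D ⇒ binop o c d
⊢-binop-cong ∧o f _ g _ =
  ⇒I (∧I (⇒E (wk1 f) (∧E₁ (ax (here refl)))) (⇒E (wk1 g) (∧E₂ (ax (here refl)))))
⊢-binop-cong ∨o f _ g _ =
  ⇒I (∨E (ax (here refl)) (∨I₁ (⇒E (wk1 (wk1 f)) (ax (here refl)))) (∨I₂ (⇒E (wk1 (wk1 g)) (ax (here refl)))))
⊢-binop-cong ⇒o _ f' g _ =
  ⇒I (⇒I (⇒E (wk1 (wk1 g)) (⇒E (ax (there (here refl))) (⇒E (wk1 (wk1 f')) (ax (here refl))))))

derivability : List Fm → Entailment 0ℓ
derivability Γ = record
  { Valid      = Γ ⊢_
  ; _≼_        = λ X Y → Γ ⊢ X ⇒ Y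
  ; ≼-refl     = ⇒-refl
  ; ≼-trans    = ⇒-trans
  ; binop-cong = ⊢-binop-cong
  ; ⊥-least    = ⇒I (⊥E (ax (here refl)))
  ; ⊤-greatest = ⇒I ⊤I
  ; ⊤≼X⇒X      = ⇒I ⇒-refl
  ; valid-⇒    = λ d → d
  ; valid-∧    = λ d → ∧E₁ d , ∧E₂ d
  }

valuation : ∀ {c ℓ₁ ℓ₂} (H : HeytingAlgebra c ℓ₁ ℓ₂) → (ℕ → HeytingAlgebra.Carrier H) → Entailment ℓ₂
valuation H I = record
  { Valid      = λ X → ⊤ₕ ⊑ V H I X
  ; _≼_        = λ X Y → V H I X ⊑ V H I Y
  ; ≼-refl     = HA.refl
  ; ≼-trans    = HA.trans
  ; binop-cong = cong
  ; ⊥-least    = minimum _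
  ; ⊤-greatest = maximum _
  ; ⊤≼X⇒X      = reflexive (Eq.sym ⇨-unit)
  ; valid-⇒    = λ ⊤≤x⇨y → HA.trans (∧-greatest (HA.trans (maximum _) ⊤≤x⇨y) HA.refl) ⇨-eval
  ; valid-∧    = λ ⊤≤x∧y → HA.trans ⊤≤x∧y (x∧y≤x _ _) , HA.trans ⊤≤x∧y (x∧y≤y _ _)
  }
  where
  module HA = HeytingAlgebra H
  open HA using (reflexive; module Eq; minimum; maximum; ∧-greatest; ∨-least; x∧y≤x; x∧y≤y; x≤x∨y; y≤x∨y) renaming (_≤_ to _⊑_; ⊤ to ⊤ₕ)
  open import Relation.Binary.Lattice.Properties.HeytingAlgebra H using (⇨-unit; ⇨-eval; ⇨-relax)
  cong : ∀ o {C c D d} → V H I C ⊑ V H I c → V H I c ⊑ V H I C → V H I D ⊑ V H I d → V H I d ⊑ V H I D →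
    V H I (binop o C D) ⊑ V H I (binop o c d)
  cong ∧o C≤c _ D≤d _ = ∧-greatest (HA.trans (x∧y≤x _ _) C≤c) (HA.trans (x∧y≤y _ _) D≤d)
  cong ∨o C≤c _ D≤d _ = ∨-least (HA.trans C≤c (x≤x∨y _ _)) (HA.trans D≤d (y≤x∨y _ _))
  cong ⇒o _ c≤C D≤d _ = ⇨-relax c≤C D≤d

sub : (ℕ → Fm) → Fm → Fm
sub σ (var x)  = σ x
sub σ ⊥'       = ⊥'
sub σ ⊤'       = ⊤'
sub σ (A ∧' B) = sub σ A ∧' sub σ B
sub σ (A ∨' B) = sub σ A ∨' sub σ B
sub σ (A ⇒ B)  = sub σ A ⇒ sub σ B

sub-binop : ∀ σ o X Y → sub σ (binop o X Y) ≡ binop o (sub σ X) (sub σ Y)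
sub-binop σ ∧o X Y = refl
sub-binop σ ∨o X Y = refl
sub-binop σ ⇒o X Y = refl

⊢-sub : ∀ {Γ A} σ → Γ ⊢ A → map (sub σ) Γ ⊢ sub σ A
⊢-sub σ (ax x)     = ax (∈-map⁺ (sub σ) x)
⊢-sub σ ⊤I         = ⊤I
⊢-sub σ (⊥E d)     = ⊥E (⊢-sub σ d)
⊢-sub σ (∧I d e)   = ∧I (⊢-sub σ d) (⊢-sub σ e)
⊢-sub σ (∧E₁ d)    = ∧E₁ (⊢-sub σ d)
⊢-sub σ (∧E₂ d)    = ∧E₂ (⊢-sub σ d)
⊢-sub σ (∨I₁ d)    = ∨I₁ (⊢-sub σ d)
⊢-sub σ (∨I₂ d)    = ∨I₂ (⊢-sub σ d)
⊢-sub σ (∨E d e g) = ∨E (⊢-sub σ d) (⊢-sub σ e) (⊢-sub σ g)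
⊢-sub σ (⇒I d)     = ⇒I (⊢-sub σ d)
⊢-sub σ (⇒E d e)   = ⇒E (⊢-sub σ d) (⊢-sub σ e)

sub-conj-intro : ∀ {Γ} σ F Gs → Γ ⊢ sub σ F → All (λ G → Γ ⊢ sub σ G) Gs → Γ ⊢ sub σ (conj F Gs)
sub-conj-intro σ F []       d []       = d
sub-conj-intro σ F (G ∷ Gs) d (e ∷ es) = ∧I d (sub-conj-intro σ G Gs e es)

link-derivable : ∀ σ o a b r → σ r ≡ binop o (σ a) (σ b) → All (λ F → [] ⊢ sub σ F) (link o a b r)
link-derivable σ o a b r σr≡ =
  subst (λ X → [] ⊢ σ r ⇒ X) r≡N ⇒-refl ∷ subst (λ X → [] ⊢ X ⇒ σ r) r≡N ⇒-refl ∷ []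
  where
  r≡N : σ r ≡ sub σ (binop o (var a) (var b))
  r≡N = trans σr≡ (sym (sub-binop σ o (var a) (var b)))

_[_↦_] : (ℕ → Fm) → ℕ → Fm → ℕ → Fm
(ρ [ e ↦ T ]) x with x ≟ e
... | yes _ = T
... | no  _ = ρ x

↦-here : ∀ ρ e T → (ρ [ e ↦ T ]) e ≡ T
↦-here ρ e T with e ≟ e
... | yes _  = refl
... | no e≢e = ⊥-elim (e≢e refl)

↦-there : ∀ ρ {e x} T → x ≢ e → (ρ [ e ↦ T ]) x ≡ ρ x
↦-there ρ {e} {x} T x≢e with x ≟ e
... | yes x≡e = ⊥-elim (x≢e x≡e)
... | no  _   = refl

-- unname B k ρ: send the names given to the subformulas of B back to those
-- subformulas, and every other variable x to ρ x.
unname : Fm → ℕ → (ℕ → Fm) → ℕ → Fm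
unname (var _)  k ρ = ρ
unname ⊥'       k ρ = ρ [ k ↦ ⊥' ]
unname ⊤'       k ρ = ρ [ k ↦ ⊤' ]
unname (C ∧' D) k ρ = unname D (next C k) (unname C k ρ) [ next D (next C k) ↦ C ∧' D ]
unname (C ∨' D) k ρ = unname D (next C k) (unname C k ρ) [ next D (next C k) ↦ C ∨' D ]
unname (C ⇒ D)  k ρ = unname D (next C k) (unname C k ρ) [ next D (next C k) ↦ C ⇒ D ]

mutual
  unname-frame : ∀ B k ρ x → x < k → unname B k ρ x ≡ ρ x
  unname-frame (var _)  k ρ x x<k = refl
  unname-frame ⊥'       k ρ x x<k = ↦-there ρ ⊥' (<⇒≢ x<k)
  unname-frame ⊤'       k ρ x x<k = ↦-there ρ ⊤' (<⇒≢ x<k)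
  unname-frame (C ∧' D) k ρ x x<k = unnameNode-frame (C ∧' D) C D k ρ x x<k
  unname-frame (C ∨' D) k ρ x x<k = unnameNode-frame (C ∨' D) C D k ρ x x<k
  unname-frame (C ⇒ D)  k ρ x x<k = unnameNode-frame (C ⇒ D) C D k ρ x x<k

  unnameNode-frame : ∀ T C D k ρ x → x < k →
    (unname D (next C k) (unname C k ρ) [ next D (next C k) ↦ T ]) x ≡ ρ x
  unnameNode-frame T C D k ρ x x<k = begin
    (σD [ e₂ ↦ T ]) x ≡⟨ ↦-there σD T (<⇒≢ (<-≤-trans x<k (≤-trans (next-≥ C k) (next-≥ D e₁)))) ⟩
    σD x              ≡⟨ unname-frame D e₁ σC x (<-≤-trans x<k (next-≥ C k)) ⟩
    σC x              ≡⟨ unname-frame C k ρ x x<k ⟩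
    ρ x               ∎
    where
    open ≡-Reasoning
    e₁ e₂ : ℕ
    e₁ = next C k
    e₂ = next D e₁
    σC σD : ℕ → Fm
    σC = unname C k ρ
    σD = unname D e₁ σC

Resolves : (ℕ → Fm) → Fm → ℕ → Set
Resolves σ B k = σ (name B k) ≡ B × All (λ F → [] ⊢ sub σ F) (defs B k)

mutual
  unname-resolves : ∀ {n} σ B k ρ → VarsBelow n B → n ≤ k → (∀ y → y < n → ρ y ≡ var y) →
    (∀ x → x < next B k → σ x ≡ unname B k ρ x) → Resolves σ B k
  unname-resolves σ (var y) k ρ y<n n≤k ρ-id agree =
    trans (agree y (<-≤-trans y<n n≤k)) (ρ-id y y<n) , []
  unname-resolves σ ⊥' k ρ _ _ _ agree =
    σk≡⊥ , subst (λ X → [] ⊢ X ⇒ ⊥') (sym σk≡⊥) ⇒-refl ∷ []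
    where
    σk≡⊥ : σ k ≡ ⊥'
    σk≡⊥ = trans (agree k ≤-refl) (↦-here ρ k ⊥')
  unname-resolves σ ⊤' k ρ _ _ _ agree =
    σk≡⊤ , subst (λ X → [] ⊢ (X ⇒ X) ⇒ X) (sym σk≡⊤) (⇒I ⊤I) ∷ []
    where
    σk≡⊤ : σ k ≡ ⊤'
    σk≡⊤ = trans (agree k ≤-refl) (↦-here ρ k ⊤')
  unname-resolves σ (C ∧' D) k ρ (vC , vD) = unnameNode-resolves σ ∧o C D k ρ vC vD
  unname-resolves σ (C ∨' D) k ρ (vC , vD) = unnameNode-resolves σ ∨o C D k ρ vC vD
  unname-resolves σ (C ⇒ D)  k ρ (vC , vD) = unnameNode-resolves σ ⇒o C D k ρ vC vD

  unnameNode-resolves : ∀ {n} σ o C D k ρ → VarsBelow n C → VarsBelow n D → n ≤ k →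
    (∀ y → y < n → ρ y ≡ var y) →
    (∀ x → x < suc (next D (next C k)) →
      σ x ≡ (unname D (next C k) (unname C k ρ) [ next D (next C k) ↦ binop o C D ]) x) →
    σ (next D (next C k)) ≡ binop o C D × All (λ F → [] ⊢ sub σ F) (defsNode o C D k)
  unnameNode-resolves {n} σ o C D k ρ vC vD n≤k ρ-id agree =
    σe₂≡ , AllP.++⁺ (proj₂ resC) (AllP.++⁺ (proj₂ resD) (link-derivable σ o _ _ e₂ σe₂≡node))
    where
    e₁ e₂ : ℕ
    e₁ = next C k
    e₂ = next D e₁
    σC σD : ℕ → Fm
    σC = unname C k ρ
    σD = unname D e₁ σC
    e₁≤e₂ : e₁ ≤ e₂
    e₁≤e₂ = next-≥ D e₁
    -- below e₂ the outer update is invisible, and below e₁ so is unname D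
    agreeD : ∀ x → x < e₂ → σ x ≡ σD x
    agreeD x x<e₂ = trans (agree x (m≤n⇒m≤1+n x<e₂)) (↦-there σD (binop o C D) (<⇒≢ x<e₂))
    agreeC : ∀ x → x < e₁ → σ x ≡ σC x
    agreeC x x<e₁ = trans (agreeD x (<-≤-trans x<e₁ e₁≤e₂)) (unname-frame D e₁ σC x x<e₁)
    σC-id : ∀ y → y < n → σC y ≡ var y
    σC-id y y<n = trans (unname-frame C k ρ y (<-≤-trans y<n n≤k)) (ρ-id y y<n)
    resC : Resolves σ C k
    resC = unname-resolves σ C k ρ vC n≤k ρ-id agreeC
    resD : Resolves σ D e₁
    resD = unname-resolves σ D e₁ σC vD (≤-trans n≤k (next-≥ C k)) σC-id agreeD
    σe₂≡ : σ e₂ ≡ binop o C D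
    σe₂≡ = trans (agree e₂ ≤-refl) (↦-here σD e₂ (binop o C D))
    σe₂≡node : σ e₂ ≡ binop o (σ (name C k)) (σ (name D e₁))
    σe₂≡node = trans σe₂≡ (cong₂ (binop o) (sym (proj₁ resC)) (sym (proj₁ resD)))

lemma3 : {c ℓ₁ ℓ₂ : Level} → (A : Fm) →
    Σ Fm λ M → Σ Fm λ Z →
      Regular (M ⇒ Z) ×
      (IPL⊢ A ⇔ IPL⊢ (M ⇒ Z)) ×
      ((H : HeytingAlgebra c ℓ₁ ℓ₂) → (I : ℕ → HeytingAlgebra.Carrier H) →
        HeytingAlgebra._≈_ H (V H I M) (HeytingAlgebra.⊤ H) →
        HeytingAlgebra._≤_ H (V H I A) (V H I Z))
lemma3 A = M , var r , regular , mk⇔ to from , bounded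
  where
  -- names start at k, above every variable of A and above the 0 of trivial
  k r : ℕ
  k = suc (bound A)
  r = name A k
  M : Fm
  M = conj trivial (defs A k)
  regular : Regular (M ⇒ var r)
  regular =
    conj-basicContext (defs A k) trivial-basic (defs-basic A k)
      (defs-avoid A k (s≤s z≤n) ∷ defs-unique A k) ,
    inj₁ (r , refl)
  -- A is equivalent to its name r under hypothesis M
  to : IPL⊢ A → IPL⊢ (M ⇒ var r)
  to ⊢A = ⇒I (⇒E (proj₁ (Naming.context-named (derivability (M ∷ [])) trivial A k (ax (here refl)))) (wk (λ ()) ⊢A))
  -- undoing the names maps M ⇒ r to a formula with derivable premise and conclusion A
  σ : ℕ → Fm
  σ = unname A k var
  resolved : Resolves σ A k
  resolved = unname-resolves σ A k var (varsBelow A ≤-refl) (n≤1+n _) (λ _ _ → refl) (λ _ _ → refl)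
  from : IPL⊢ (M ⇒ var r) → IPL⊢ A
  from ⊢M⇒r = subst ([] ⊢_) (proj₁ resolved)
    (⇒E (⊢-sub σ ⊢M⇒r) (sub-conj-intro σ trivial (defs A k) ⇒-refl (proj₂ resolved)))
  -- in a valuation with V(M) = ⊤, V(A) equals the value of its name
  bounded : ∀ H I → HeytingAlgebra._≈_ H (V H I M) (HeytingAlgebra.⊤ H) →
    HeytingAlgebra._≤_ H (V H I A) (V H I (var r))
  bounded H I M≈⊤ = proj₁ (Naming.context-named (valuation H I) trivial A k
    (HeytingAlgebra.reflexive H (HeytingAlgebra.Eq.sym H M≈⊤)))
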